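{- There is a deterministic $2$-round $k$-clustering algorithm that recovers every hidden $k$-clustering of an $n$-point universe exactly using $O(n\log k)$ subset queries.
   Context: Let $U$ be a set of $n$ points with a hidden partition $U=C_1\sqcup\cdots\sqcup C_k$. A subset query on $S\subseteq U$ returns $\mathsf{count}(S)=|\{i\in[k]: C_i\cap S\neq\emptyset\}|$. A $2$-round algorithm specifies a first batch of queries, receives all answers, then (depending on these answers) specifies a second batch of queries, receives all answers, and then outputs the clustering. -}

module Defs where

open import Data.Nat using (ℕ; _+_; _*_; _≤_)
open import Data.Nat.Logarithm using (⌈log₂_⌉)
open import Data.Bool using (Bool)
open import Data.Fin using (Fin; _≟_)
open import Data.Fin.Properties using (any?)
open import Data.Fin.Subset using (Subset; _∈_; ∣_∣)
open import Data.Fin.Subset.Properties using (_∈?_)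
open import Data.Vec using (Vec; tabulate)
import Data.Vec
open import Data.Product using (Σ; ∃; _×_; _,_)
open import Function.Bundles using (_⇔_)
open import Relation.Binary.PropositionalEquality using (_≡_)
open import Relation.Nullary.Decidable using (⌊_⌋; _×-dec_)

-- A hidden k-clustering of the universe Fin n: a labelling of the points by
-- cluster indices, C_i = { x | f x ≡ i }. Every cluster is nonempty (partition).
Labelling : ℕ → ℕ → Set
Labelling n k = Fin n → Fin k

IsClustering : ∀ {n k} → Labelling n k → Set
IsClustering {n} {k} f = ∀ (i : Fin k) → ∃ λ (x : Fin n) → f x ≡ i

hit : ∀ {n k} → Labelling n k → Subset n → Subset k
hit f S = tabulate λ i → ⌊ any? (λ x → (x ∈? S) ×-dec (f x ≟ i)) ⌋

count : ∀ {n k} → Labelling n k → Subset n → ℕ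
count f S = ∣ hit f S ∣

answers : ∀ {n k m} → Labelling n k → Vec (Subset n) m → Vec ℕ m
answers f Q = Data.Vec.map (count f) Q

record TwoRoundAlg (n k : ℕ) : Set where
  field
    m₁      : ℕ
    batch₁  : Vec (Subset n) m₁
    m₂      : Vec ℕ m₁ → ℕ
    batch₂  : (a₁ : Vec ℕ m₁) → Vec (Subset n) (m₂ a₁)
    output  : (a₁ : Vec ℕ m₁) → Vec ℕ (m₂ a₁) → Labelling n k

  ans₁ : Labelling n k → Vec ℕ m₁
  ans₁ f = answers f batch₁

  numQueries : Labelling n k → ℕ
  numQueries f = m₁ + m₂ (ans₁ f)

  result : Labelling n k → Labelling n k
  result f = output (ans₁ f) (answers f (batch₂ (ans₁ f)))

open TwoRoundAlg public

-- Two labellings induce the same partition (exact recovery, up to renaming).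
SamePartition : ∀ {n k} → Labelling n k → Labelling n k → Set
SamePartition {n} f g = ∀ (x y : Fin n) → (f x ≡ f y) ⇔ (g x ≡ g y)

RecoversWith : ∀ {n k} → TwoRoundAlg n k → ℕ → Set
RecoversWith {n} {k} A B = ∀ (f : Labelling n k) → IsClustering f →
  SamePartition f (result A f) × numQueries A f ≤ B

{-# OPTIONS --safe #-}
module Submission where

-- Round one asks the n + 1 prefix queries {y | y < t}. Their answers jump exactly at the
-- leaders, the first points of the clusters, and the answer just before a jump (the number of
-- clusters met earlier) is a label < k that tells the clusters apart. Round two spells these
-- labels in binary with L = ⌈log₂ k⌉ digits: if T_j is the set of leaders whose label has digit j
-- set, then the label of x has digit j set iff adding x to T_j leaves count T_j unchanged.
-- Asking T_j and every T_j ∪ {x} takes (n + 1)(L + 1) ≤ 4nL queries in total.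

open import Defs
open import Data.Bool.Base using (Bool; T)
open import Data.Bool.Properties using (T-≡)
open import Data.Fin.Base using (Fin; zero; suc; toℕ; inject₁; combine; remQuot; finToFun; funToFin)
open import Data.Fin.Properties
  using (toℕ-injective; toℕ-inject₁; toℕ-fromℕ<; remQuot-combine; funToFin-finToFin; 2↔Bool; nonZeroIndex)
open import Data.Fin.Subset using (Subset; _∈_; _∉_; _⊆_; _∪_; ⁅_⁆; ∣_∣)
open import Data.Fin.Subset.Properties
  using (_∈?_; ⊆-antisym; p⊆q⇒∣p∣≤∣q∣; p⊂q⇒∣p∣<∣q∣; ∣p∣≤n; ∪⇔⊎; p⊆p∪q; q⊆p∪q; x∈⁅x⁆; x∈⁅y⁆⇔x≡y)
open import Data.List.Base using ([]; _∷_)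
open import Data.Nat.Base using (ℕ; zero; suc; _+_; _*_; _^_; _≤_; _<_; z≤n; s≤s; NonZero; >-nonZero⁻¹; ⌈_/2⌉)
open import Data.Nat.DivMod using (_mod_; m<n⇒m%n≡m)
open import Data.Nat.Induction using (Acc; acc; <-wellFounded)
open import Data.Nat.Logarithm using (⌈log₂_⌉; ⌈log₂⌉-mono-≤)
open import Data.Nat.Logarithm.Core using (⌈log2⌉)
open import Data.Nat.Properties
  using (_≟_; _<?_; ≤-refl; ≤-trans; <-≤-trans; <-cmp; <⇒≢; n<1+n; m≤n⇒m≤1+n; m<1+n⇒m<n∨m≡n;
         +-suc; +-monoˡ-≤; *-suc; *-mono-≤; *-monoʳ-≤; m^n≢0; module ≤-Reasoning)
open import Data.Nat.Tactic.RingSolver using (solve)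
open import Data.Product.Base using (Σ; ∃; _×_; _,_; proj₁; proj₂)
open import Data.Sum.Base using (inj₁; inj₂)
open import Data.Vec.Base using (Vec; tabulate; lookup)
open import Data.Vec.Properties using (lookup∘tabulate; lookup-map; []=⇒lookup; lookup⇒[]=)
open import Function.Base using (_∘_)
open import Function.Bundles using (_⇔_; mk⇔; Equivalence; Inverse)
open import Function.Properties.Equivalence using () renaming (sym to ⇔-sym; trans to ⇔-trans)
open import Relation.Binary.Definitions using (tri<; tri≈; tri>)
open import Relation.Binary.PropositionalEquality
  using (_≡_; _≢_; _≗_; refl; sym; trans; cong; cong₂; subst; subst₂; module ≡-Reasoning)
open import Relation.Nullary.Decidable
  using (yes; no; ⌊_⌋; ¬?; _×-dec_; T?; toWitness; fromWitness; isYes≗does; does-⇔)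
open import Relation.Nullary.Negation using (contradiction)
open import Relation.Unary using (Pred; Decidable)

open Equivalence using (to; from)

∈-tabulate⇔ : ∀ {n p} {P : Pred (Fin n) p} (P? : Decidable P) {x : Fin n} →
              x ∈ tabulate (λ y → ⌊ P? y ⌋) ⇔ P x
∈-tabulate⇔ P? {x} = mk⇔
  (λ x∈ → toWitness (from T-≡ (trans (sym (lookup∘tabulate _ x)) ([]=⇒lookup x∈))))
  (λ Px → lookup⇒[]= x _ (trans (lookup∘tabulate _ x) (to T-≡ (fromWitness Px))))

n≤2*⌈n/2⌉ : ∀ n → n ≤ 2 * ⌈ n /2⌉
n≤2*⌈n/2⌉ 0             = z≤n
n≤2*⌈n/2⌉ 1             = s≤s z≤n
n≤2*⌈n/2⌉ (suc (suc n)) = s≤s (subst (suc n ≤_) (sym (+-suc h (h + 0))) (s≤s (n≤2*⌈n/2⌉ n)))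
  where h = ⌈ n /2⌉

n≤2^⌈log2⌉n : ∀ n (rec : Acc _<_ n) → n ≤ 2 ^ ⌈log2⌉ n rec
n≤2^⌈log2⌉n 0             _        = z≤n
n≤2^⌈log2⌉n 1             _        = s≤s z≤n
n≤2^⌈log2⌉n (suc (suc n)) (acc rs) =
  ≤-trans (n≤2*⌈n/2⌉ (2 + n)) (*-monoʳ-≤ 2 (n≤2^⌈log2⌉n (suc ⌈ n /2⌉) _))

n≤2^⌈log₂n⌉ : ∀ n → n ≤ 2 ^ ⌈log₂ n ⌉
n≤2^⌈log₂n⌉ n = n≤2^⌈log2⌉n n (<-wellFounded n)

m<n⇒toℕ[m-mod-n]≡m : ∀ {m n} .{{_ : NonZero n}} → m < n → toℕ (m mod n) ≡ m
m<n⇒toℕ[m-mod-n]≡m m<n = trans (toℕ-fromℕ< _) (m<n⇒m%n≡m m<n)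

funToFin-cong : ∀ {m n} {v w : Fin m → Fin n} → v ≗ w → funToFin v ≡ funToFin w
funToFin-cong {zero}  _   = refl
funToFin-cong {suc m} v≗w = cong₂ combine (v≗w zero) (funToFin-cong (v≗w ∘ suc))

module FixedWidthBinary (L : ℕ) where

  instance
    2^L-nonZero : NonZero (2 ^ L)
    2^L-nonZero = m^n≢0 2 L

  bits : ℕ → Fin L → Bool
  bits a = Inverse.to 2↔Bool ∘ finToFun (a mod 2 ^ L)

  unbits : (Fin L → Bool) → ℕ
  unbits w = toℕ (funToFin (Inverse.from 2↔Bool ∘ w))

  unbits-cong : ∀ {v w} → v ≗ w → unbits v ≡ unbits w
  unbits-cong v≗w = cong toℕ (funToFin-cong (cong (Inverse.from 2↔Bool) ∘ v≗w))

  unbits-bits : ∀ {a} → a < 2 ^ L → unbits (bits a) ≡ a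
  unbits-bits {a} a<2^L = begin
    unbits (bits a)           ≡⟨ cong toℕ (funToFin-cong (Inverse.strictlyInverseʳ 2↔Bool ∘ digits)) ⟩
    toℕ (funToFin digits)     ≡⟨ cong toℕ (funToFin-finToFin {L} {2} (a mod 2 ^ L)) ⟩
    toℕ (a mod 2 ^ L)         ≡⟨ m<n⇒toℕ[m-mod-n]≡m a<2^L ⟩
    a                         ∎
    where
    open ≡-Reasoning
    digits : Fin L → Fin 2
    digits = finToFun (a mod 2 ^ L)

module _ {n k} (f : Labelling n k) where

  ∈-hit⇔ : ∀ {S i} → i ∈ hit f S ⇔ ∃ λ x → x ∈ S × f x ≡ i
  ∈-hit⇔ = ∈-tabulate⇔ _

  ∈-hit⁺ : ∀ {S x} → x ∈ S → f x ∈ hit f S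
  ∈-hit⁺ x∈S = from ∈-hit⇔ (_ , x∈S , refl)

  hit-mono : ∀ {S S'} → S ⊆ S' → hit f S ⊆ hit f S'
  hit-mono S⊆S' i∈ with x , x∈S , refl ← to ∈-hit⇔ i∈ = ∈-hit⁺ (S⊆S' x∈S)

  count-mono : ∀ {S S'} → S ⊆ S' → count f S ≤ count f S'
  count-mono = p⊆q⇒∣p∣≤∣q∣ ∘ hit-mono

  count-∪⁅⁆-hit : ∀ {S x} → f x ∈ hit f S → count f (S ∪ ⁅ x ⁆) ≡ count f S
  count-∪⁅⁆-hit {S} {x} fx∈ = cong ∣_∣ (⊆-antisym shrink (hit-mono (p⊆p∪q ⁅ x ⁆)))
    where
    shrink : hit f (S ∪ ⁅ x ⁆) ⊆ hit f S
    shrink i∈ with y , y∈ , refl ← to ∈-hit⇔ i∈ with to ∪⇔⊎ y∈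
    ... | inj₁ y∈S = ∈-hit⁺ y∈S
    ... | inj₂ y∈⁅x⁆ = subst (λ z → f z ∈ hit f S) (sym (to x∈⁅y⁆⇔x≡y y∈⁅x⁆)) fx∈

  count-∪⁅⁆-miss : ∀ {S x} → f x ∉ hit f S → count f S < count f (S ∪ ⁅ x ⁆)
  count-∪⁅⁆-miss {S} {x} fx∉ =
    p⊂q⇒∣p∣<∣q∣ (hit-mono (p⊆p∪q ⁅ x ⁆) , f x , ∈-hit⁺ (q⊆p∪q S ⁅ x ⁆ (x∈⁅x⁆ x)) , fx∉)

  count-∪⁅⁆≡⇔ : ∀ {S x} → count f (S ∪ ⁅ x ⁆) ≡ count f S ⇔ f x ∈ hit f S
  count-∪⁅⁆≡⇔ {S} {x} = mk⇔ still count-∪⁅⁆-hit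
    where
    still : count f (S ∪ ⁅ x ⁆) ≡ count f S → f x ∈ hit f S
    still eq with f x ∈? hit f S
    ... | yes fx∈ = fx∈
    ... | no  fx∉ = contradiction (sym eq) (<⇒≢ (count-∪⁅⁆-miss fx∉))

prefix : ∀ {n} → ℕ → Subset n
prefix t = tabulate λ y → ⌊ toℕ y <? t ⌋

∈-prefix⇔ : ∀ {n t} {y : Fin n} → y ∈ prefix t ⇔ toℕ y < t
∈-prefix⇔ = ∈-tabulate⇔ _

prefix-mono : ∀ {n t t'} → t ≤ t' → prefix {n} t ⊆ prefix t'
prefix-mono t≤t' y∈ = from ∈-prefix⇔ (<-≤-trans (to ∈-prefix⇔ y∈) t≤t')

prefix-suc : ∀ {n} (r : Fin n) → prefix (suc (toℕ r)) ≡ prefix (toℕ r) ∪ ⁅ r ⁆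
prefix-suc r = ⊆-antisym split merge
  where
  split : prefix (suc (toℕ r)) ⊆ prefix (toℕ r) ∪ ⁅ r ⁆
  split y∈ with m<1+n⇒m<n∨m≡n (to ∈-prefix⇔ y∈)
  ... | inj₁ y<r = from ∪⇔⊎ (inj₁ (from ∈-prefix⇔ y<r))
  ... | inj₂ y≡r = from ∪⇔⊎ (inj₂ (from x∈⁅y⁆⇔x≡y (toℕ-injective y≡r)))
  merge : prefix (toℕ r) ∪ ⁅ r ⁆ ⊆ prefix (suc (toℕ r))
  merge y∈ with to ∪⇔⊎ y∈
  ... | inj₁ y∈prefix = prefix-mono (m≤n⇒m≤1+n ≤-refl) y∈prefix
  ... | inj₂ y∈⁅r⁆ rewrite to x∈⁅y⁆⇔x≡y y∈⁅r⁆ = from ∈-prefix⇔ ≤-refl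

module Leaders {n k} (f : Labelling n k) where

  prefixCount : ℕ → ℕ
  prefixCount t = count f (prefix t)

  Leader : Fin n → Set
  Leader r = f r ∉ hit f (prefix (toℕ r))

  leader⇔count-step : ∀ {r} → Leader r ⇔ prefixCount (suc (toℕ r)) ≢ prefixCount (toℕ r)
  leader⇔count-step {r} rewrite prefix-suc r = mk⇔
    (λ fr∉ eq → fr∉ (to (count-∪⁅⁆≡⇔ f) eq))
    (λ neq fr∈ → neq (from (count-∪⁅⁆≡⇔ f) fr∈))

  leader-count-< : ∀ {r t} → Leader r → toℕ r < t → prefixCount (toℕ r) < prefixCount t
  leader-count-< {r} fr∉ r<t = <-≤-trans
    (subst (prefixCount (toℕ r) <_) (cong (count f) (sym (prefix-suc r))) (count-∪⁅⁆-miss f fr∉))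
    (count-mono f (prefix-mono r<t))

  leader-first : ∀ {r r' : Fin n} → Leader r' → toℕ r < toℕ r' → f r ≢ f r'
  leader-first fr'∉ r<r' fr≡fr' = fr'∉ (subst (_∈ hit f _) fr≡fr' (∈-hit⁺ f (from ∈-prefix⇔ r<r')))

  leader-unique : ∀ {r r'} → Leader r → Leader r' → f r ≡ f r' → r ≡ r'
  leader-unique {r} {r'} lr lr' eq with <-cmp (toℕ r) (toℕ r')
  ... | tri< r<r' _ _ = contradiction eq (leader-first lr' r<r')
  ... | tri≈ _ r≡r' _ = toℕ-injective r≡r'
  ... | tri> _ _ r>r' = contradiction (sym eq) (leader-first lr r>r')

  leader-count-injective : ∀ {r r'} → Leader r → Leader r' →
                           prefixCount (toℕ r) ≡ prefixCount (toℕ r') → r ≡ r'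
  leader-count-injective {r} {r'} lr lr' eq with <-cmp (toℕ r) (toℕ r')
  ... | tri< r<r' _ _ = contradiction eq (<⇒≢ (leader-count-< lr r<r'))
  ... | tri≈ _ r≡r' _ = toℕ-injective r≡r'
  ... | tri> _ _ r>r' = contradiction (sym eq) (<⇒≢ (leader-count-< lr' r>r'))

  leader-exists : ∀ x → Acc _<_ (toℕ x) → ∃ λ r → Leader r × f r ≡ f x
  leader-exists x (acc rs) with f x ∈? hit f (prefix (toℕ x))
  ... | no  fx∉ = x , fx∉ , refl
  ... | yes fx∈ with y , y∈ , fy≡fx ← to (∈-hit⇔ f) fx∈
                with r , lr , fr≡fy ← leader-exists y (rs (to ∈-prefix⇔ y∈))
                = r , lr , trans fr≡fy fy≡fx

  leader : Fin n → Fin n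
  leader x = proj₁ (leader-exists x (<-wellFounded (toℕ x)))

  leader-isLeader : ∀ x → Leader (leader x)
  leader-isLeader x = proj₁ (proj₂ (leader-exists x (<-wellFounded (toℕ x))))

  f∘leader : ∀ x → f (leader x) ≡ f x
  f∘leader x = proj₂ (proj₂ (leader-exists x (<-wellFounded (toℕ x))))

  label : Fin n → ℕ
  label x = prefixCount (toℕ (leader x))

  label<k : ∀ x → label x < k
  label<k x = <-≤-trans (leader-count-< (leader-isLeader x) (n<1+n _))
                        (∣p∣≤n (hit f (prefix (suc (toℕ (leader x))))))

  label≡⇔ : ∀ {x y} → label x ≡ label y ⇔ f x ≡ f y
  label≡⇔ {x} {y} = mk⇔
    (λ eq → begin
      f x          ≡⟨ f∘leader x ⟨
      f (leader x) ≡⟨ cong f (leader-count-injective (leader-isLeader x) (leader-isLeader y) eq) ⟩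
      f (leader y) ≡⟨ f∘leader y ⟩
      f y          ∎)
    (λ eq → cong (prefixCount ∘ toℕ) (leader-unique (leader-isLeader x) (leader-isLeader y) (begin
      f (leader x) ≡⟨ f∘leader x ⟩
      f x          ≡⟨ eq ⟩
      f y          ≡⟨ f∘leader y ⟨
      f (leader y) ∎)))
    where open ≡-Reasoning

module PrefixThenBits (n k : ℕ) .{{_ : NonZero k}} where

  L : ℕ
  L = ⌈log₂ k ⌉

  open FixedWidthBinary L

  prefixes : Vec (Subset n) (suc n)
  prefixes = tabulate (prefix ∘ toℕ)

  JumpsAt : Vec ℕ (suc n) → Fin n → Set
  JumpsAt a r = lookup a (suc r) ≢ lookup a (inject₁ r)

  jumpsAt? : ∀ a → Decidable (JumpsAt a)
  jumpsAt? a r = ¬? (lookup a (suc r) ≟ lookup a (inject₁ r))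

  rankAt : Vec ℕ (suc n) → Fin n → ℕ
  rankAt a r = lookup a (inject₁ r)

  leadersWithBit : Vec ℕ (suc n) → Fin L → Subset n
  leadersWithBit a j = tabulate λ r → ⌊ jumpsAt? a r ×-dec T? (bits (rankAt a r) j) ⌋

  probe : Vec ℕ (suc n) → Fin (suc n) × Fin L → Subset n
  probe a (zero  , j) = leadersWithBit a j
  probe a (suc x , j) = leadersWithBit a j ∪ ⁅ x ⁆

  probes : Vec ℕ (suc n) → Vec (Subset n) (suc n * L)
  probes a = tabulate (probe a ∘ remQuot L)

  readBit : Vec ℕ (suc n * L) → Fin n → Fin L → Bool
  readBit a₂ x j = ⌊ lookup a₂ (combine {suc n} (suc x) j) ≟ lookup a₂ (combine {suc n} zero j) ⌋

  -- Labels are < k, so mod k only serves to land in Fin k.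
  decode : Vec ℕ (suc n) → Vec ℕ (suc n * L) → Labelling n k
  decode _ a₂ x = unbits (readBit a₂ x) mod k

  algorithm : TwoRoundAlg n k
  algorithm = record
    { m₁ = suc n ; batch₁ = prefixes ; m₂ = λ _ → suc n * L ; batch₂ = probes ; output = decode }

  module Correctness (f : Labelling n k) where

    open Leaders f

    a₁ : Vec ℕ (suc n)
    a₁ = ans₁ algorithm f

    a₂ : Vec ℕ (suc n * L)
    a₂ = answers f (probes a₁)

    lookup-a₁ : ∀ t → lookup a₁ t ≡ prefixCount (toℕ t)
    lookup-a₁ t = trans (lookup-map t (count f) prefixes) (cong (count f) (lookup∘tabulate (prefix ∘ toℕ) t))

    rankAt-a₁ : ∀ r → rankAt a₁ r ≡ prefixCount (toℕ r)
    rankAt-a₁ r = trans (lookup-a₁ (inject₁ r)) (cong prefixCount (toℕ-inject₁ r))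

    jumpsAt⇔leader : ∀ {r} → JumpsAt a₁ r ⇔ Leader r
    jumpsAt⇔leader {r} rewrite lookup-a₁ (suc r) | rankAt-a₁ r = ⇔-sym leader⇔count-step

    hit-leadersWithBit⇔ : ∀ {x j} → f x ∈ hit f (leadersWithBit a₁ j) ⇔ T (bits (label x) j)
    hit-leadersWithBit⇔ {x} {j} = mk⇔ bitSet selectsLeader
      where
      bitSet : f x ∈ hit f (leadersWithBit a₁ j) → T (bits (label x) j)
      bitSet fx∈ with r , r∈ , fr≡fx ← to (∈-hit⇔ f) fx∈ with jumps , bit ← to (∈-tabulate⇔ _) r∈
        with refl ← leader-unique (to jumpsAt⇔leader jumps) (leader-isLeader x)
                                  (trans fr≡fx (sym (f∘leader x)))
        = subst (λ m → T (bits m j)) (rankAt-a₁ r) bit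
      selectsLeader : T (bits (label x) j) → f x ∈ hit f (leadersWithBit a₁ j)
      selectsLeader bit = from (∈-hit⇔ f) (leader x , leader∈ , f∘leader x)
        where
        leader∈ : leader x ∈ leadersWithBit a₁ j
        leader∈ = from (∈-tabulate⇔ _) ( from jumpsAt⇔leader (leader-isLeader x)
                                       , subst (λ m → T (bits m j)) (sym (rankAt-a₁ (leader x))) bit)

    lookup-a₂ : ∀ o j → lookup a₂ (combine o j) ≡ count f (probe a₁ (o , j))
    lookup-a₂ o j = trans (lookup-map (combine o j) (count f) (probes a₁)) (cong (count f) (begin
      lookup (probes a₁) (combine o j)   ≡⟨ lookup∘tabulate (probe a₁ ∘ remQuot L) (combine o j) ⟩
      probe a₁ (remQuot L (combine o j)) ≡⟨ cong (probe a₁) (remQuot-combine o j) ⟩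
      probe a₁ (o , j)                   ∎))
      where open ≡-Reasoning

    readBit-correct : ∀ x j → readBit a₂ x j ≡ bits (label x) j
    readBit-correct x j = trans (isYes≗does (_ ≟ _)) (does-⇔ probesAgree (_ ≟ _) (T? (bits (label x) j)))
      where
      probesAgree : (lookup a₂ (combine {suc n} (suc x) j) ≡ lookup a₂ (combine {suc n} zero j))
                    ⇔ T (bits (label x) j)
      probesAgree = subst₂ (λ u v → (u ≡ v) ⇔ T (bits (label x) j))
        (sym (lookup-a₂ (suc x) j)) (sym (lookup-a₂ zero j))
        (⇔-trans (count-∪⁅⁆≡⇔ f) hit-leadersWithBit⇔)

    toℕ-result : ∀ x → toℕ (result algorithm f x) ≡ label x
    toℕ-result x = begin
      toℕ (unbits (readBit a₂ x) mod k)  ≡⟨ cong (λ m → toℕ (m mod k)) (unbits-cong (readBit-correct x)) ⟩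
      toℕ (unbits (bits (label x)) mod k) ≡⟨ cong (λ m → toℕ (m mod k)) (unbits-bits label<2^L) ⟩
      toℕ (label x mod k)                 ≡⟨ m<n⇒toℕ[m-mod-n]≡m (label<k x) ⟩
      label x                             ∎
      where
      open ≡-Reasoning
      label<2^L : label x < 2 ^ L
      label<2^L = <-≤-trans (label<k x) (n≤2^⌈log₂n⌉ k)

    recovers : SamePartition f (result algorithm f)
    recovers x y = mk⇔
      (λ fx≡fy → toℕ-injective (trans (toℕ-result x) (trans (from label≡⇔ fx≡fy) (sym (toℕ-result y)))))
      (λ rx≡ry → to label≡⇔ (trans (sym (toℕ-result x)) (trans (cong toℕ rx≡ry) (toℕ-result y))))

query-budget : ∀ {n L} → 1 ≤ n → 1 ≤ L → suc n + suc n * L ≤ 4 * n * L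
query-budget {n} {L} 1≤n 1≤L = begin
  suc n + suc n * L ≡⟨ *-suc (suc n) L ⟨
  suc n * suc L     ≤⟨ *-mono-≤ (+-monoˡ-≤ n 1≤n) (+-monoˡ-≤ L 1≤L) ⟩
  (n + n) * (L + L) ≡⟨ solve (n ∷ L ∷ []) ⟩
  4 * n * L         ∎
  where open ≤-Reasoning

-- Recovery holds for every labelling; that all clusters are nonempty is only needed for n ≥ 1.
theorem5p1 : ∃ λ (c : ℕ) → ∀ (n k : ℕ) → 2 ≤ k →
    Σ (TwoRoundAlg n k) λ A → RecoversWith A (c * n * ⌈log₂ k ⌉)
theorem5p1 = 4 , λ where
  n k@(suc _) 2≤k → PrefixThenBits.algorithm n k , λ f clustering →
    PrefixThenBits.Correctness.recovers n k f ,
    query-budget (>-nonZero⁻¹ n {{nonZeroIndex (proj₁ (clustering zero))}}) (⌈log₂⌉-mono-≤ 2≤k)
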